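{- Let $V$ be an $n$-dimensional vector space over $\mathbb{F}_q$, let $k$ be a positive integer with $k\le n/2$, and let $\mathcal{S}$ be a family of $s\ge2$ subspaces of $V$ of dimension $k$. Assume there is an integer $d\ge 2$ such that (1) for every hyperplane $H$ of $V$, $|\{M\in\mathcal{S}: M\subseteq H\}|\in\{0,d\}$, with both values occurring; and (2) $M\cap M^*=\{0\}$ for all distinct $M,M^*\in\mathcal{S}$. Then $d\ge q^{n-3k}$ or $n\le 4k-1$. -}

module Defs where

open import Level using (0ℓ)
open import Data.Nat using (ℕ; zero; suc)
open import Data.Fin using (Fin; zero; suc)
open import Data.Fin.Subset using (Subset; _∈_; ∣_∣)
open import Data.Product using (Σ; ∃; _×_; _,_)
open import Relation.Nullary using (¬_)
open import Relation.Binary.PropositionalEquality as ≡ using (_≡_)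
open import Algebra.Bundles using (CommutativeRing)
open import Function.Bundles using (Inverse; _⇔_)

record FiniteField (q : ℕ) : Set₁ where
  field
    commRing : CommutativeRing 0ℓ 0ℓ
  open CommutativeRing commRing public
  field
    0≉1     : ¬ (0# ≈ 1#)
    inverse : ∀ x → ¬ (x ≈ 0#) → ∃ λ y → x * y ≈ 1#
    card    : Inverse setoid (≡.setoid (Fin q))

module LinearAlgebra {q : ℕ} (F : FiniteField q) where
  open FiniteField F using (Carrier; _≈_; _+_; _*_; 0#)

  Vect : ℕ → Set
  Vect n = Fin n → Carrier

  ∑ : ∀ {k} → (Fin k → Carrier) → Carrier
  ∑ {zero}  f = 0#
  ∑ {suc k} f = f zero + ∑ (λ i → f (suc i))

  IsZero : ∀ {n} → Vect n → Set
  IsZero x = ∀ j → x j ≈ 0#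

  lincomb : ∀ {n k} → (Fin k → Carrier) → (Fin k → Vect n) → Vect n
  lincomb c b j = ∑ (λ i → c i * b i j)

  LinearlyIndependent : ∀ {n k} → (Fin k → Vect n) → Set
  LinearlyIndependent b = ∀ c → IsZero (lincomb c b) → ∀ i → c i ≈ 0#

  record Subspace (n k : ℕ) : Set where
    field
      basis : Fin k → Vect n
      indep : LinearlyIndependent basis

  _∈ˢ_ : ∀ {n k} → Vect n → Subspace n k → Set
  x ∈ˢ M = ∃ λ c → ∀ j → x j ≈ lincomb c (Subspace.basis M) j

  -- a hyperplane is the kernel of a nonzero linear functional a
  record Hyperplane (n : ℕ) : Set where
    field
      normal  : Vect n
      nonzero : ¬ IsZero normal

  _∈ʰ_ : ∀ {n} → Vect n → Hyperplane n → Set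
  x ∈ʰ H = ∑ (λ j → Hyperplane.normal H j * x j) ≈ 0#

  _⊆ʰ_ : ∀ {n k} → Subspace n k → Hyperplane n → Set
  M ⊆ʰ H = ∀ x → x ∈ˢ M → x ∈ʰ H

  TrivialIntersection : ∀ {n k} → Subspace n k → Subspace n k → Set
  TrivialIntersection M M' = ∀ x → x ∈ˢ M → x ∈ˢ M' → IsZero x

HasCount : ∀ {s} → (Fin s → Set) → ℕ → Set
HasCount {s} P d = Σ (Subset s) λ σ → (∣ σ ∣ ≡ d) × (∀ i → (i ∈ σ) ⇔ P i)

{-# OPTIONS --safe #-}

-- For a ∈ F_q^n let c(a) be the number of members of 𝒮 contained in the hyperplane a^⊥, so c(0) = s.
-- Counting solutions of linear systems by Gaussian elimination gives Σ_a c(a) = s q^(n-k) and, since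
-- two members of 𝒮 together span a 2k-dimensional space, Σ_a c(a)² = s q^(n-k) + s(s-1) q^(n-2k).
-- For a ≠ 0 we have c(a) ∈ {0, d}, hence c(a)² = d c(a), and comparing the two sums yields
-- (s-1)(q^(n-2k) - 1) = (d-1)(q^(n-k) - 1). So q^(n-2k) - 1 divides (d-1)(q^k - 1), which forces
-- d > q^(n-3k) whenever n ≥ 3k. Thus the first alternative always holds.

module Submission where

open import Defs
open import Data.Nat using (ℕ; _≤_; _*_; _∸_; _^_)
open import Data.Fin using (Fin)
open import Data.Product using (∃; _×_)
open import Data.Sum using (_⊎_)
open import Relation.Nullary using (¬_)
open import Relation.Binary.PropositionalEquality using (_≡_; _≢_)

open import Data.Bool using (if_then_else_)
open import Data.Empty using (⊥-elim)
open import Data.Fin using (zero; suc; punchIn; punchOut; _↑ˡ_; _↑ʳ_; splitAt; join)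
import Data.Fin.Properties as Fin
open import Data.Fin.Subset using (Subset; inside; outside; ∣_∣)
open import Data.Fin.Subset.Properties using (_∈?_)
open import Data.Nat as ℕ using (zero; suc; z≤n; s≤s; NonZero; _≤?_)
import Data.Nat.Properties as ℕₚ
open import Data.Product using (_,_; proj₁; proj₂)
open import Data.Sum using (inj₁; inj₂)
import Data.Vec as Vec
open import Data.Vec.Functional using (_∷_; tail; insertAt; removeAt; _++_)
open import Data.Vec.Functional.Properties using (insertAt-punchIn; insertAt-lookup; lookup-++ˡ; lookup-++ʳ)
open import Function using (_∘_)
open import Function.Bundles using (Inverse; Injection; _⇔_; mk⇔; Equivalence)
open import Function.Construct.Composition using (_⇔-∘_)
open import Function.Construct.Symmetry using (⇔-sym)
open import Function.Properties.Inverse using (Inverse⇒Injection)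
open import Relation.Nullary using (Dec; yes; no; does; ¬?)
open import Relation.Nullary.Decidable using (_×-dec_; via-injection; decidable-stable)
import Relation.Binary.PropositionalEquality as ≡

↑-induction : ∀ {m n} (P : Fin (m ℕ.+ n) → Set) → (∀ i → P (i ↑ˡ n)) → (∀ j → P (m ↑ʳ j)) → ∀ l → P l
↑-induction {m} {n} P left right l = ≡.subst P (Fin.join-splitAt m n l) (onSplit (splitAt m l))
  where
  onSplit : ∀ s → P (join m n s)
  onSplit (inj₁ i) = left i
  onSplit (inj₂ j) = right j

module LinearAlgebraFacts {q : ℕ} (F : FiniteField q) where
  open FiniteField F hiding (zero) renaming (_*_ to _·_)
  open LinearAlgebra F
  open import Algebra.Properties.Ring ring using (-‿distribˡ-*)
  open import Algebra.Properties.Group +-group using (inverseˡ-unique; ε⁻¹≈ε)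
  open import Algebra.Properties.AbelianGroup +-abelianGroup using (⁻¹-∙-comm)
  open import Algebra.Properties.CommutativeSemigroup *-commutativeSemigroup
    using () renaming (x∙yz≈y∙xz to x·[y·z]≈y·[x·z])
  open import Algebra.Properties.Semiring.Sum semiring
    using () renaming (sum to sumᶠ; ∑-distrib-+ to sumᶠ-distrib-+; ∑-comm to sumᶠ-comm; sum-remove to sumᶠ-remove)
  open import Relation.Binary.Reasoning.Setoid setoid

  infix 4 _≈?_
  _≈?_ : (x y : Carrier) → Dec (x ≈ y)
  _≈?_ = via-injection (Inverse⇒Injection card) Fin._≟_

  ∑-cong : ∀ {m} {f g : Fin m → Carrier} → (∀ i → f i ≈ g i) → ∑ f ≈ ∑ g
  ∑-cong {zero}  f≈g = refl
  ∑-cong {suc m} f≈g = +-cong (f≈g zero) (∑-cong (f≈g ∘ suc))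

  ∑-zero : ∀ {m} {f : Fin m → Carrier} → (∀ i → f i ≈ 0#) → ∑ f ≈ 0#
  ∑-zero {zero}  f≈0 = refl
  ∑-zero {suc m} f≈0 = trans (+-cong (f≈0 zero) (∑-zero (f≈0 ∘ suc))) (+-identityˡ 0#)

  ∑-neg : ∀ {m} (f : Fin m → Carrier) → ∑ (λ i → - f i) ≈ - ∑ f
  ∑-neg {zero}  f = sym ε⁻¹≈ε
  ∑-neg {suc m} f = trans (+-congˡ (∑-neg (f ∘ suc))) (⁻¹-∙-comm _ _)

  ∑-*ˡ : ∀ {m} c (f : Fin m → Carrier) → c · ∑ f ≈ ∑ (λ i → c · f i)
  ∑-*ˡ {zero}  c f = zeroʳ c
  ∑-*ˡ {suc m} c f = trans (distribˡ c _ _) (+-congˡ (∑-*ˡ c (f ∘ suc)))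

  ∑-*ʳ : ∀ {m} c (f : Fin m → Carrier) → ∑ f · c ≈ ∑ (λ i → f i · c)
  ∑-*ʳ {zero}  c f = zeroˡ c
  ∑-*ʳ {suc m} c f = trans (distribʳ c _ _) (+-congˡ (∑-*ʳ c (f ∘ suc)))

  ∑≈sumᶠ : ∀ {m} (f : Fin m → Carrier) → ∑ f ≈ sumᶠ f
  ∑≈sumᶠ {zero}  f = refl
  ∑≈sumᶠ {suc m} f = +-congˡ (∑≈sumᶠ (f ∘ suc))

  ∑-+ : ∀ {m} (f g : Fin m → Carrier) → ∑ (λ i → f i + g i) ≈ ∑ f + ∑ g
  ∑-+ f g = begin
    ∑ (λ i → f i + g i)     ≈⟨ ∑≈sumᶠ (λ i → f i + g i) ⟩
    sumᶠ (λ i → f i + g i)  ≈⟨ sumᶠ-distrib-+ f g ⟩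
    sumᶠ f + sumᶠ g         ≈⟨ +-cong (∑≈sumᶠ f) (∑≈sumᶠ g) ⟨
    ∑ f + ∑ g               ∎

  ∑-comm : ∀ {m n} (f : Fin m → Fin n → Carrier) → ∑ (λ i → ∑ (f i)) ≈ ∑ (λ j → ∑ (λ i → f i j))
  ∑-comm f = begin
    ∑ (λ i → ∑ (f i))                ≈⟨ ∑-cong (λ i → ∑≈sumᶠ (f i)) ⟩
    ∑ (λ i → sumᶠ (f i))             ≈⟨ ∑≈sumᶠ (λ i → sumᶠ (f i)) ⟩
    sumᶠ (λ i → sumᶠ (f i))          ≈⟨ sumᶠ-comm f ⟩
    sumᶠ (λ j → sumᶠ (λ i → f i j))  ≈⟨ ∑≈sumᶠ (λ j → sumᶠ (λ i → f i j)) ⟨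
    ∑ (λ j → sumᶠ (λ i → f i j))     ≈⟨ ∑-cong (λ j → ∑≈sumᶠ (λ i → f i j)) ⟨
    ∑ (λ j → ∑ (λ i → f i j))        ∎

  ∑-removeAt : ∀ {m} (p : Fin (suc m)) (f : Fin (suc m) → Carrier) → ∑ f ≈ f p + ∑ (removeAt f p)
  ∑-removeAt p f = begin
    ∑ f                            ≈⟨ ∑≈sumᶠ f ⟩
    sumᶠ f                         ≈⟨ sumᶠ-remove {i = p} f ⟩
    f p + sumᶠ (removeAt f p)      ≈⟨ +-congˡ (∑≈sumᶠ (removeAt f p)) ⟨
    f p + ∑ (removeAt f p)         ∎

  ∑-split : ∀ {m n} (f : Fin (m ℕ.+ n) → Carrier) → ∑ f ≈ ∑ (λ i → f (i ↑ˡ n)) + ∑ (λ j → f (m ↑ʳ j))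
  ∑-split {zero}  f = sym (+-identityˡ _)
  ∑-split {suc m} f = trans (+-congˡ (∑-split {m} (f ∘ suc))) (sym (+-assoc _ _ _))

  dot : ∀ {n} → Vect n → Vect n → Carrier
  dot a x = ∑ (λ j → a j · x j)

  dot-congʳ : ∀ {n} (a : Vect n) {x y : Vect n} → (∀ j → x j ≈ y j) → dot a x ≈ dot a y
  dot-congʳ a x≈y = ∑-cong (λ j → *-congˡ (x≈y j))

  dot-zeroˡ : ∀ {n} {a : Vect n} (x : Vect n) → IsZero a → dot a x ≈ 0#
  dot-zeroˡ x a≈0 = ∑-zero (λ j → trans (*-congʳ (a≈0 j)) (zeroˡ (x j)))

  dot-lincomb : ∀ {n k} (a : Vect n) (c : Fin k → Carrier) (b : Fin k → Vect n)
              → dot a (lincomb c b) ≈ ∑ (λ i → c i · dot a (b i))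
  dot-lincomb a c b = begin
    ∑ (λ j → a j · ∑ (λ i → c i · b i j))
      ≈⟨ ∑-cong (λ j → ∑-*ˡ (a j) (λ i → c i · b i j)) ⟩
    ∑ (λ j → ∑ (λ i → a j · (c i · b i j)))
      ≈⟨ ∑-comm (λ j i → a j · (c i · b i j)) ⟩
    ∑ (λ i → ∑ (λ j → a j · (c i · b i j)))
      ≈⟨ ∑-cong (λ i → ∑-cong (λ j → x·[y·z]≈y·[x·z] (a j) (c i) (b i j))) ⟩
    ∑ (λ i → ∑ (λ j → c i · (a j · b i j)))
      ≈⟨ ∑-cong (λ i → ∑-*ˡ (c i) (λ j → a j · b i j)) ⟨
    ∑ (λ i → c i · dot a (b i))
      ∎

  dot-∷ : ∀ {n} x (a : Vect n) (v : Vect (suc n)) → v zero ≈ 0# → dot (x ∷ a) v ≈ dot a (tail v)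
  dot-∷ x a v v₀≈0 = trans (+-congʳ (trans (*-congˡ v₀≈0) (zeroʳ x))) (+-identityˡ _)

  infixl 6 _+[_]·_
  _+[_]·_ : ∀ {n} → Vect n → Carrier → Vect n → Vect n
  (v +[ c ]· w) l = v l + c · w l

  dot-+[]· : ∀ {n} (a v w : Vect n) c → dot a (v +[ c ]· w) ≈ dot a v + c · dot a w
  dot-+[]· a v w c = begin
    ∑ (λ l → a l · (v l + c · w l))
      ≈⟨ ∑-cong (λ l → trans (distribˡ (a l) _ _) (+-congˡ (x·[y·z]≈y·[x·z] (a l) c (w l)))) ⟩
    ∑ (λ l → a l · v l + c · (a l · w l))
      ≈⟨ ∑-+ (λ l → a l · v l) (λ l → c · (a l · w l)) ⟩
    dot a v + ∑ (λ l → c · (a l · w l))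
      ≈⟨ +-congˡ (∑-*ˡ c (λ l → a l · w l)) ⟨
    dot a v + c · dot a w
      ∎

  lincomb-+[]· : ∀ {n r} (c μ : Fin r → Carrier) (u : Fin r → Vect n) (w : Vect n) l
               → lincomb c (λ j → u j +[ μ j ]· w) l ≈ lincomb c u l + ∑ (λ j → c j · μ j) · w l
  lincomb-+[]· c μ u w l = begin
    ∑ (λ j → c j · (u j l + μ j · w l))
      ≈⟨ ∑-cong (λ j → trans (distribˡ (c j) _ _) (+-congˡ (sym (*-assoc (c j) (μ j) (w l))))) ⟩
    ∑ (λ j → c j · u j l + c j · μ j · w l)
      ≈⟨ ∑-+ (λ j → c j · u j l) (λ j → c j · μ j · w l) ⟩
    lincomb c u l + ∑ (λ j → c j · μ j · w l)
      ≈⟨ +-congˡ (∑-*ʳ (w l) (λ j → c j · μ j)) ⟨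
    lincomb c u l + ∑ (λ j → c j · μ j) · w l
      ∎

  lincomb-insertAt : ∀ {n r} (c : Fin r → Carrier) (p : Fin (suc r)) x (b : Fin (suc r) → Vect n) l
                   → lincomb (insertAt c p x) b l ≈ x · b p l + lincomb c (removeAt b p) l
  lincomb-insertAt c p x b l = begin
    lincomb (insertAt c p x) b l
      ≈⟨ ∑-removeAt p (λ i → insertAt c p x i · b i l) ⟩
    insertAt c p x p · b p l + ∑ (λ j → insertAt c p x (punchIn p j) · b (punchIn p j) l)
      ≈⟨ +-cong (*-congʳ (reflexive (insertAt-lookup c p x)))
                (∑-cong (λ j → *-congʳ (reflexive (insertAt-punchIn c p x j)))) ⟩
    x · b p l + lincomb c (removeAt b p) l
      ∎

  basis-∈ˢ : ∀ {n k} (M : Subspace n k) i → Subspace.basis M i ∈ˢ M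
  basis-∈ˢ {k = suc k} M i = insertAt (λ _ → 0#) i 1# , λ l → sym (begin
    lincomb (insertAt (λ _ → 0#) i 1#) B l     ≈⟨ lincomb-insertAt (λ _ → 0#) i 1# B l ⟩
    1# · B i l + lincomb (λ _ → 0#) (removeAt B i) l
      ≈⟨ +-cong (*-identityˡ (B i l)) (∑-zero (λ j → zeroˡ (B (punchIn i j) l))) ⟩
    B i l + 0#                                  ≈⟨ +-identityʳ (B i l) ⟩
    B i l                                       ∎)
    where B = Subspace.basis M

  infix 4 _⊥_ _⊥?_
  _⊥_ : ∀ {n r} → Vect n → (Fin r → Vect n) → Set
  a ⊥ b = ∀ i → dot a (b i) ≈ 0#

  _⊥?_ : ∀ {n r} (a : Vect n) (b : Fin r → Vect n) → Dec (a ⊥ b)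
  a ⊥? b = Fin.all? (λ i → dot a (b i) ≈? 0#)

  ⊥-basis⇔⊆ʰ : ∀ {n k} (H : Hyperplane n) (M : Subspace n k) → Hyperplane.normal H ⊥ Subspace.basis M ⇔ M ⊆ʰ H
  ⊥-basis⇔⊆ʰ H M = mk⇔ contained (λ M⊆H i → M⊆H (B i) (basis-∈ˢ M i))
    where
    a = Hyperplane.normal H
    B = Subspace.basis M
    contained : a ⊥ B → M ⊆ʰ H
    contained a⊥B x (c , x≈) = begin
      dot a x                       ≈⟨ dot-congʳ a x≈ ⟩
      dot a (lincomb c B)           ≈⟨ dot-lincomb a c B ⟩
      ∑ (λ i → c i · dot a (B i))   ≈⟨ ∑-zero (λ i → trans (*-congˡ (a⊥B i)) (zeroʳ (c i))) ⟩
      0#                            ∎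

  ⊥-removeAt⇔ : ∀ {n r} (a : Vect n) (b : Fin (suc r) → Vect n) p → a ⊥ b ⇔ (dot a (b p) ≈ 0# × a ⊥ removeAt b p)
  ⊥-removeAt⇔ a b p = mk⇔ (λ a⊥b → a⊥b p , a⊥b ∘ punchIn p) from
    where
    from : dot a (b p) ≈ 0# × a ⊥ removeAt b p → a ⊥ b
    from (a⊥bp , a⊥rest) i with p Fin.≟ i
    ... | yes ≡.refl = a⊥bp
    ... | no p≢i     = ≡.subst (λ i → dot a (b i) ≈ 0#) (Fin.punchIn-punchOut p≢i) (a⊥rest (punchOut p≢i))

  ⊥-++⇔ : ∀ {n r t} (a : Vect n) (u : Fin r → Vect n) (v : Fin t → Vect n) → a ⊥ (u ++ v) ⇔ (a ⊥ u × a ⊥ v)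
  ⊥-++⇔ {r = r} {t} a u v = mk⇔
    (λ a⊥uv → (λ i → ⊥-at (lookup-++ˡ u v i) (a⊥uv (i ↑ˡ t))) , (λ j → ⊥-at (lookup-++ʳ u v j) (a⊥uv (r ↑ʳ j))))
    (λ (a⊥u , a⊥v) → ↑-induction (λ l → dot a ((u ++ v) l) ≈ 0#)
      (λ i → ⊥-at (≡.sym (lookup-++ˡ u v i)) (a⊥u i)) (λ j → ⊥-at (≡.sym (lookup-++ʳ u v j)) (a⊥v j)))
    where
    ⊥-at : ∀ {x y} → x ≡ y → dot a x ≈ 0# → dot a y ≈ 0#
    ⊥-at = ≡.subst (λ x → dot a x ≈ 0#)

  ++-independent : ∀ {n k} (M M′ : Subspace n k) → TrivialIntersection M M′
                 → LinearlyIndependent (Subspace.basis M ++ Subspace.basis M′)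
  ++-independent {n} {k} M M′ M∩M′≈0 c Σ≈0 = ↑-induction (λ l → c l ≈ 0#)
      (Subspace.indep M c₁ u≈0) (Subspace.indep M′ c₂ v≈0)
    where
    B  = Subspace.basis M
    B′ = Subspace.basis M′
    c₁ c₂ : Fin k → Carrier
    c₁ i = c (i ↑ˡ k)
    c₂ j = c (k ↑ʳ j)
    u v : Vect n
    u = lincomb c₁ B
    v = lincomb c₂ B′
    u+v≈0 : ∀ l → u l + v l ≈ 0#
    u+v≈0 l = begin
      u l + v l
        ≈⟨ +-cong (∑-cong (λ i → *-congˡ (reflexive (≡.cong (λ w → w l) (≡.sym (lookup-++ˡ B B′ i))))))
                  (∑-cong (λ j → *-congˡ (reflexive (≡.cong (λ w → w l) (≡.sym (lookup-++ʳ B B′ j)))))) ⟩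
      ∑ (λ i → c (i ↑ˡ k) · (B ++ B′) (i ↑ˡ k) l) + ∑ (λ j → c (k ↑ʳ j) · (B ++ B′) (k ↑ʳ j) l)
        ≈⟨ ∑-split {k} {k} (λ i → c i · (B ++ B′) i l) ⟨
      lincomb c (B ++ B′) l
        ≈⟨ Σ≈0 l ⟩
      0# ∎
    u∈M′ : u ∈ˢ M′
    u∈M′ = (λ j → - c₂ j) , λ l → begin
      u l                             ≈⟨ inverseˡ-unique (u l) (v l) (u+v≈0 l) ⟩
      - v l                           ≈⟨ ∑-neg (λ j → c₂ j · B′ j l) ⟨
      ∑ (λ j → - (c₂ j · B′ j l))     ≈⟨ ∑-cong (λ j → -‿distribˡ-* (c₂ j) (B′ j l)) ⟩
      lincomb (λ j → - c₂ j) B′ l     ∎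
    u≈0 : IsZero u
    u≈0 = M∩M′≈0 u (c₁ , λ _ → refl) u∈M′
    v≈0 : IsZero v
    v≈0 l = trans (sym (trans (+-congʳ (u≈0 l)) (+-identityˡ (v l)))) (u+v≈0 l)

  tail-independent : ∀ {n r} {b : Fin r → Vect (suc n)} → (∀ i → b i zero ≈ 0#)
                   → LinearlyIndependent b → LinearlyIndependent (tail ∘ b)
  tail-independent {b = b} b₀≈0 b-indep c Σ≈0 = b-indep c λ
    { zero    → ∑-zero (λ i → trans (*-congˡ (b₀≈0 i)) (zeroʳ (c i)))
    ; (suc l) → Σ≈0 l }

  ∷-⊥⇔⊥-tail : ∀ {n r} {b : Fin r → Vect (suc n)} → (∀ i → b i zero ≈ 0#)
             → ∀ x (a : Vect n) → (x ∷ a) ⊥ b ⇔ a ⊥ (tail ∘ b)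
  ∷-⊥⇔⊥-tail {b = b} b₀≈0 x a = mk⇔
    (λ xa⊥b i → trans (sym (dot-∷ x a (b i) (b₀≈0 i))) (xa⊥b i))
    (λ a⊥b i → trans (dot-∷ x a (b i) (b₀≈0 i)) (a⊥b i))

  +[]·-independent : ∀ {n r} {b : Fin (suc r) → Vect n} (p : Fin (suc r)) (μ : Fin r → Carrier)
                   → LinearlyIndependent b → LinearlyIndependent (λ j → b (punchIn p j) +[ μ j ]· b p)
  +[]·-independent {b = b} p μ b-indep c Σ≈0 j = begin
    c j                         ≡⟨ insertAt-punchIn c p Λ j ⟨
    insertAt c p Λ (punchIn p j) ≈⟨ b-indep (insertAt c p Λ) Σ′≈0 (punchIn p j) ⟩
    0#                          ∎
    where
    Λ = ∑ (λ j → c j · μ j)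
    Σ′≈0 : IsZero (lincomb (insertAt c p Λ) b)
    Σ′≈0 l = begin
      lincomb (insertAt c p Λ) b l                             ≈⟨ lincomb-insertAt c p Λ b l ⟩
      Λ · b p l + lincomb c (removeAt b p) l                   ≈⟨ +-comm _ _ ⟩
      lincomb c (removeAt b p) l + Λ · b p l                   ≈⟨ lincomb-+[]· c μ (removeAt b p) (b p) l ⟨
      lincomb c (λ j → b (punchIn p j) +[ μ j ]· b p) l        ≈⟨ Σ≈0 l ⟩
      0#                                                       ∎

  module _ {π ι : Carrier} (π·ι≈1 : π · ι ≈ 1#) where

    -[x·ι]·π≈-x : ∀ x → - (x · ι) · π ≈ - x
    -[x·ι]·π≈-x x = begin
      - (x · ι) · π    ≈⟨ -‿distribˡ-* (x · ι) π ⟨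
      - (x · ι · π)    ≈⟨ -‿cong (*-assoc x ι π) ⟩
      - (x · (ι · π))  ≈⟨ -‿cong (*-congˡ (trans (*-comm ι π) π·ι≈1)) ⟩
      - (x · 1#)       ≈⟨ -‿cong (*-identityʳ x) ⟩
      - x              ∎

    linear-solution⇔ : ∀ x D → x · π + D ≈ 0# ⇔ x ≈ - (D · ι)
    linear-solution⇔ x D = mk⇔
      (λ x·π+D≈0 → begin
        x            ≈⟨ *-identityʳ x ⟨
        x · 1#       ≈⟨ *-congˡ π·ι≈1 ⟨
        x · (π · ι)  ≈⟨ *-assoc x π ι ⟨
        x · π · ι    ≈⟨ *-congʳ (inverseˡ-unique (x · π) D x·π+D≈0) ⟩
        - D · ι      ≈⟨ -‿distribˡ-* D ι ⟨
        - (D · ι)    ∎)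
      (λ x≈ → begin
        x · π + D          ≈⟨ +-congʳ (*-congʳ x≈) ⟩
        - (D · ι) · π + D  ≈⟨ +-congʳ (-[x·ι]·π≈-x D) ⟩
        - D + D            ≈⟨ -‿inverseˡ D ⟩
        0#                 ∎)

  module Elimination {n r} (b : Fin (suc r) → Vect (suc n)) (p : Fin (suc r)) (pivot≉0 : ¬ b p zero ≈ 0#) where

    pivot⁻¹ : Carrier
    pivot⁻¹ = proj₁ (inverse (b p zero) pivot≉0)

    pivot·pivot⁻¹≈1 : b p zero · pivot⁻¹ ≈ 1#
    pivot·pivot⁻¹≈1 = proj₂ (inverse (b p zero) pivot≉0)

    multiplier : Fin r → Carrier
    multiplier j = - (b (punchIn p j) zero · pivot⁻¹)

    eliminated : Fin r → Vect (suc n)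
    eliminated j = b (punchIn p j) +[ multiplier j ]· b p

    eliminated-head≈0 : ∀ j → eliminated j zero ≈ 0#
    eliminated-head≈0 j = trans (+-congˡ (-[x·ι]·π≈-x pivot·pivot⁻¹≈1 _)) (-‿inverseʳ _)

    reduced : Fin r → Vect n
    reduced = tail ∘ eliminated

    reduced-independent : LinearlyIndependent b → LinearlyIndependent reduced
    reduced-independent = tail-independent eliminated-head≈0 ∘ +[]·-independent {b = b} p multiplier

    pivotValue : Vect n → Carrier
    pivotValue a = - (dot a (tail (b p)) · pivot⁻¹)

    ∷-⊥⇔ : ∀ x (a : Vect n) → (x ∷ a) ⊥ b ⇔ (x ≈ pivotValue a × a ⊥ reduced)
    ∷-⊥⇔ x a = mk⇔
      (λ xa⊥b → let (xa⊥bp , xa⊥rest) = Equivalence.to (⊥-removeAt⇔ (x ∷ a) b p) xa⊥b in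
        Equivalence.to pivotRow⇔ xa⊥bp , λ j → trans (otherRows xa⊥bp j) (xa⊥rest j))
      (λ (x≈ , a⊥reduced) → let xa⊥bp = Equivalence.from pivotRow⇔ x≈ in
        Equivalence.from (⊥-removeAt⇔ (x ∷ a) b p) (xa⊥bp , λ j → trans (sym (otherRows xa⊥bp j)) (a⊥reduced j)))
      where
      pivotRow⇔ : dot (x ∷ a) (b p) ≈ 0# ⇔ x ≈ pivotValue a
      pivotRow⇔ = linear-solution⇔ pivot·pivot⁻¹≈1 x (dot a (tail (b p)))
      otherRows : dot (x ∷ a) (b p) ≈ 0# → ∀ j → dot a (reduced j) ≈ dot (x ∷ a) (b (punchIn p j))
      otherRows xa⊥bp j = begin
        dot a (reduced j)
          ≈⟨ dot-∷ x a (eliminated j) (eliminated-head≈0 j) ⟨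
        dot (x ∷ a) (eliminated j)
          ≈⟨ dot-+[]· (x ∷ a) (b (punchIn p j)) (b p) (multiplier j) ⟩
        dot (x ∷ a) (b (punchIn p j)) + multiplier j · dot (x ∷ a) (b p)
          ≈⟨ +-congˡ (trans (*-congˡ xa⊥bp) (zeroʳ (multiplier j))) ⟩
        dot (x ∷ a) (b (punchIn p j)) + 0#
          ≈⟨ +-identityʳ _ ⟩
        dot (x ∷ a) (b (punchIn p j))
          ∎

open import Data.Nat using (_+_)
open import Data.Nat.Tactic.RingSolver using (solve-∀)
open import Data.Nat.Divisibility using (_∣_; ∣⇒≤; ∣m+n∣m⇒∣n; n∣m*n)
open ≡ using (refl; sym; trans; cong; cong₂; module ≡-Reasoning)
open import Algebra.Properties.Semiring.Sum ℕₚ.+-*-semiring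
  using (sum; sum-cong-≗; sum-remove; ∑-distrib-+; *-distribˡ-sum; *-distribʳ-sum)

𝟙 : {A : Set} → Dec A → ℕ
𝟙 p? = if does p? then 1 else 0

𝟙-yes : {A : Set} → A → (p? : Dec A) → 𝟙 p? ≡ 1
𝟙-yes p (yes _) = refl
𝟙-yes p (no ¬p) = ⊥-elim (¬p p)

𝟙-no : {A : Set} → ¬ A → (p? : Dec A) → 𝟙 p? ≡ 0
𝟙-no ¬p (yes p) = ⊥-elim (¬p p)
𝟙-no ¬p (no _)  = refl

𝟙-cong : {A B : Set} → A ⇔ B → (p? : Dec A) (q? : Dec B) → 𝟙 p? ≡ 𝟙 q?
𝟙-cong A⇔B (yes p) q? = sym (𝟙-yes (Equivalence.to A⇔B p) q?)
𝟙-cong A⇔B (no ¬p) q? = sym (𝟙-no (¬p ∘ Equivalence.from A⇔B) q?)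

𝟙-× : {A B C : Set} → C ⇔ (A × B) → (r? : Dec C) (p? : Dec A) (q? : Dec B) → 𝟙 r? ≡ 𝟙 p? * 𝟙 q?
𝟙-× C⇔A×B r? p? q? = trans (𝟙-cong C⇔A×B r? (p? ×-dec q?)) (𝟙-×-dec p? q?)
  where
  𝟙-×-dec : ∀ {A B : Set} (p? : Dec A) (q? : Dec B) → 𝟙 (p? ×-dec q?) ≡ 𝟙 p? * 𝟙 q?
  𝟙-×-dec (yes _) (yes _) = refl
  𝟙-×-dec (yes _) (no _)  = refl
  𝟙-×-dec (no _)  _       = refl

𝟙-idem : {A : Set} (p? : Dec A) → 𝟙 p? * 𝟙 p? ≡ 𝟙 p?
𝟙-idem (yes _) = refl
𝟙-idem (no _)  = refl

sum-const : ∀ m c → sum {m} (λ _ → c) ≡ m * c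
sum-const zero    c = refl
sum-const (suc m) c = cong (c +_) (sum-const m c)

sum-𝟙-≟ : ∀ {m} (y : Fin m) → sum (λ x → 𝟙 (x Fin.≟ y)) ≡ 1
sum-𝟙-≟ {suc m} y = begin
  sum (λ x → 𝟙 (x Fin.≟ y))
    ≡⟨ sum-remove {i = y} (λ x → 𝟙 (x Fin.≟ y)) ⟩
  𝟙 (y Fin.≟ y) + sum (λ j → 𝟙 (punchIn y j Fin.≟ y))
    ≡⟨ cong₂ _+_ (𝟙-yes refl (y Fin.≟ y))
                 (sum-cong-≗ (λ j → 𝟙-no (Fin.punchInᵢ≢i y j) (punchIn y j Fin.≟ y))) ⟩
  1 + sum {m} (λ _ → 0)
    ≡⟨ cong suc (trans (sum-const m 0) (ℕₚ.*-zeroʳ m)) ⟩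
  1
    ∎
  where open ≡-Reasoning

sum-𝟙-∈ : ∀ {s} (σ : Subset s) → sum (λ i → 𝟙 (i ∈? σ)) ≡ ∣ σ ∣
sum-𝟙-∈ Vec.[]              = refl
sum-𝟙-∈ (inside  Vec.∷ σ) = cong suc (sum-𝟙-∈ σ)
sum-𝟙-∈ (outside Vec.∷ σ) = sum-𝟙-∈ σ

≢⇒2≤ : ∀ {m} {i j : Fin m} → i ≢ j → 2 ≤ m
≢⇒2≤ {i = zero}  {zero}  i≢j = ⊥-elim (i≢j refl)
≢⇒2≤ {i = zero}  {suc j} _   = s≤s (ℕₚ.≤-trans (s≤s z≤n) (Fin.toℕ<n j))
≢⇒2≤ {i = suc i} {_}     _   = s≤s (ℕₚ.≤-trans (s≤s z≤n) (Fin.toℕ<n i))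

module Counting {q : ℕ} (F : FiniteField q) where
  open FiniteField F using (Carrier; _≈_; 0#; 1#; 0≉1; card) renaming (sym to ≈-sym)
  open LinearAlgebra F
  open LinearAlgebraFacts F

  fromFin : Fin q → Carrier
  fromFin = Inverse.from card

  2≤q : 2 ≤ q
  2≤q = ≢⇒2≤ (0≉1 ∘ Injection.injective (Inverse⇒Injection card))

  instance
    q≢0 : NonZero q
    q≢0 = ℕ.>-nonZero (ℕₚ.≤-trans (s≤s z≤n) 2≤q)

  2≤q^ : ∀ {k} → 1 ≤ k → 2 ≤ q ^ k
  2≤q^ 1≤k = ℕₚ.≤-trans 2≤q (ℕₚ.≤-trans (ℕₚ.≤-reflexive (sym (ℕₚ.*-identityʳ q))) (ℕₚ.^-monoʳ-≤ q 1≤k))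

  sum-𝟙-fromFin≈ : ∀ c → sum (λ x → 𝟙 (fromFin x ≈? c)) ≡ 1
  sum-𝟙-fromFin≈ c =
    trans (sum-cong-≗ (λ x → 𝟙-cong (fromFin≈⇔ x) (fromFin x ≈? c) (x Fin.≟ Inverse.to card c)))
          (sum-𝟙-≟ (Inverse.to card c))
    where
    fromFin≈⇔ : ∀ x → fromFin x ≈ c ⇔ x ≡ Inverse.to card c
    fromFin≈⇔ x = mk⇔ (λ x≈c → sym (Inverse.inverseˡ card (≈-sym x≈c))) (Inverse.inverseʳ card)

  ∑ⱽ : ∀ n → (Vect n → ℕ) → ℕ
  ∑ⱽ zero    f = f (λ ())
  ∑ⱽ (suc n) f = sum (λ x → ∑ⱽ n (λ a → f (fromFin x ∷ a)))

  ∑ⱽ-cong : ∀ n {f g : Vect n → ℕ} → (∀ a → f a ≡ g a) → ∑ⱽ n f ≡ ∑ⱽ n g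
  ∑ⱽ-cong zero    f≗g = f≗g _
  ∑ⱽ-cong (suc n) f≗g = sum-cong-≗ (λ x → ∑ⱽ-cong n (λ a → f≗g (fromFin x ∷ a)))

  ∑ⱽ-+ : ∀ n (f g : Vect n → ℕ) → ∑ⱽ n (λ a → f a + g a) ≡ ∑ⱽ n f + ∑ⱽ n g
  ∑ⱽ-+ zero    f g = refl
  ∑ⱽ-+ (suc n) f g = trans (sum-cong-≗ (λ x → ∑ⱽ-+ n (λ a → f (fromFin x ∷ a)) (λ a → g (fromFin x ∷ a))))
                           (∑-distrib-+ (λ x → ∑ⱽ n (λ a → f (fromFin x ∷ a))) (λ x → ∑ⱽ n (λ a → g (fromFin x ∷ a))))

  ∑ⱽ-*ˡ : ∀ n c (f : Vect n → ℕ) → ∑ⱽ n (λ a → c * f a) ≡ c * ∑ⱽ n f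
  ∑ⱽ-*ˡ zero    c f = refl
  ∑ⱽ-*ˡ (suc n) c f = trans (sum-cong-≗ (λ x → ∑ⱽ-*ˡ n c (λ a → f (fromFin x ∷ a))))
                            (sym (*-distribˡ-sum c (λ x → ∑ⱽ n (λ a → f (fromFin x ∷ a)))))

  ∑ⱽ-sum : ∀ n {m} (f : Fin m → Vect n → ℕ) → ∑ⱽ n (λ a → sum (λ i → f i a)) ≡ sum (λ i → ∑ⱽ n (f i))
  ∑ⱽ-sum n {zero}  f = ∑ⱽ-*ˡ n 0 (λ _ → 0)
  ∑ⱽ-sum n {suc m} f = trans (∑ⱽ-+ n (f zero) (λ a → sum (λ i → f (suc i) a)))
                             (cong (∑ⱽ n (f zero) +_) (∑ⱽ-sum n (f ∘ suc)))

  ∑ⱽ-const-head : ∀ n {f : Vect (suc n) → ℕ} {g : Vect n → ℕ}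
                → (∀ x a → f (x ∷ a) ≡ g a) → ∑ⱽ (suc n) f ≡ q * ∑ⱽ n g
  ∑ⱽ-const-head n f≡g = trans (sum-cong-≗ (λ x → ∑ⱽ-cong n (f≡g (fromFin x)))) (sum-const q _)

  ∑ⱽ-graph : ∀ n {f : Vect (suc n) → ℕ} (G : Vect n → Carrier) (g : Vect n → ℕ)
           → (∀ x a → f (x ∷ a) ≡ 𝟙 (x ≈? G a) * g a) → ∑ⱽ (suc n) f ≡ ∑ⱽ n g
  ∑ⱽ-graph n {f} G g f≡ = begin
    sum (λ x → ∑ⱽ n (λ a → f (fromFin x ∷ a)))
      ≡⟨ sum-cong-≗ (λ x → ∑ⱽ-cong n (f≡ (fromFin x))) ⟩
    sum (λ x → ∑ⱽ n (λ a → 𝟙 (fromFin x ≈? G a) * g a))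
      ≡⟨ ∑ⱽ-sum n (λ x a → 𝟙 (fromFin x ≈? G a) * g a) ⟨
    ∑ⱽ n (λ a → sum (λ x → 𝟙 (fromFin x ≈? G a) * g a))
      ≡⟨ ∑ⱽ-cong n (λ a → *-distribʳ-sum (g a) (λ x → 𝟙 (fromFin x ≈? G a))) ⟨
    ∑ⱽ n (λ a → sum (λ x → 𝟙 (fromFin x ≈? G a)) * g a)
      ≡⟨ ∑ⱽ-cong n (λ a → trans (cong (_* g a) (sum-𝟙-fromFin≈ (G a))) (ℕₚ.*-identityˡ (g a))) ⟩
    ∑ⱽ n g
      ∎
    where open ≡-Reasoning

  isZero? : ∀ {n} (a : Vect n) → Dec (IsZero a)
  isZero? a = Fin.all? (λ j → a j ≈? 0#)

  ∑ⱽ-𝟙-isZero : ∀ n → ∑ⱽ n (λ a → 𝟙 (isZero? a)) ≡ 1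
  ∑ⱽ-𝟙-isZero zero    = 𝟙-yes (λ ()) (isZero? {zero} (λ ()))
  ∑ⱽ-𝟙-isZero (suc n) = trans
    (∑ⱽ-graph n {f = λ v → 𝟙 (isZero? v)} (λ _ → 0#) (λ a → 𝟙 (isZero? a))
              (λ x a → 𝟙-× (∷-isZero⇔ x a) (isZero? (x ∷ a)) (x ≈? 0#) (isZero? a)))
    (∑ⱽ-𝟙-isZero n)
    where
    ∷-isZero⇔ : ∀ x (a : Vect n) → IsZero (x ∷ a) ⇔ (x ≈ 0# × IsZero a)
    ∷-isZero⇔ x a = mk⇔ (λ xa≈0 → xa≈0 zero , xa≈0 ∘ suc)
                        (λ { (x≈0 , a≈0) zero → x≈0 ; (x≈0 , a≈0) (suc j) → a≈0 j })

  #⊥ : ∀ {n r} → (Fin r → Vect n) → ℕ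
  #⊥ {n} b = ∑ⱽ n (λ a → 𝟙 (a ⊥? b))

  #⊥-tail : ∀ {n r} (b : Fin r → Vect (suc n)) → (∀ i → b i zero ≈ 0#) → #⊥ b ≡ q * #⊥ (tail ∘ b)
  #⊥-tail {n} b b₀≈0 = ∑ⱽ-const-head n {f = λ v → 𝟙 (v ⊥? b)}
    (λ x a → 𝟙-cong (∷-⊥⇔⊥-tail {b = b} b₀≈0 x a) ((x ∷ a) ⊥? b) (a ⊥? tail ∘ b))

  #⊥-reduced : ∀ {n r} (b : Fin (suc r) → Vect (suc n)) p (b₀≉0 : ¬ b p zero ≈ 0#)
             → #⊥ b ≡ #⊥ (Elimination.reduced b p b₀≉0)
  #⊥-reduced {n} b p b₀≉0 = ∑ⱽ-graph n {f = λ v → 𝟙 (v ⊥? b)} pivotValue (λ a → 𝟙 (a ⊥? reduced))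
    (λ x a → 𝟙-× (∷-⊥⇔ x a) ((x ∷ a) ⊥? b) (x ≈? pivotValue a) (a ⊥? reduced))
    where open Elimination b p b₀≉0

  #⊥-tail-step : ∀ {n r} (b : Fin r → Vect (suc n)) → (∀ i → b i zero ≈ 0#)
               → #⊥ (tail ∘ b) * q ^ r ≡ q ^ n → #⊥ b * q ^ r ≡ q ^ suc n
  #⊥-tail-step {n} {r} b b₀≈0 count = begin
    #⊥ b * q ^ r                 ≡⟨ cong (_* q ^ r) (#⊥-tail b b₀≈0) ⟩
    q * #⊥ (tail ∘ b) * q ^ r    ≡⟨ ℕₚ.*-assoc q (#⊥ (tail ∘ b)) (q ^ r) ⟩
    q * (#⊥ (tail ∘ b) * q ^ r)  ≡⟨ cong (q *_) count ⟩
    q ^ suc n                    ∎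
    where open ≡-Reasoning

  #⊥-reduced-step : ∀ {n r} (b : Fin (suc r) → Vect (suc n)) p (b₀≉0 : ¬ b p zero ≈ 0#)
                  → #⊥ (Elimination.reduced b p b₀≉0) * q ^ r ≡ q ^ n → #⊥ b * q ^ suc r ≡ q ^ suc n
  #⊥-reduced-step {n} {r} b p b₀≉0 count = begin
    #⊥ b * (q * q ^ r)        ≡⟨ cong (_* (q * q ^ r)) (#⊥-reduced b p b₀≉0) ⟩
    #⊥ reduced * (q * q ^ r)  ≡⟨ x*[y*z]≡y*[x*z] (#⊥ reduced) q (q ^ r) ⟩
    q * (#⊥ reduced * q ^ r)  ≡⟨ cong (q *_) count ⟩
    q ^ suc n                 ∎
    where
    open ≡-Reasoning
    open Elimination b p b₀≉0
    open import Algebra.Properties.CommutativeSemigroup ℕₚ.*-commutativeSemigroup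
      using () renaming (x∙yz≈y∙xz to x*[y*z]≡y*[x*z])

  #⊥-independent : ∀ n r (b : Fin r → Vect n) → LinearlyIndependent b → #⊥ b * q ^ r ≡ q ^ n
  #⊥-independent zero    zero    b _       = cong (_* 1) (𝟙-yes (λ ()) ((λ ()) ⊥? b))
  #⊥-independent zero    (suc r) b b-indep = ⊥-elim (0≉1 (≈-sym (b-indep (λ _ → 1#) (λ ()) zero)))
  #⊥-independent (suc n) zero    b b-indep =
    #⊥-tail-step b (λ ()) (#⊥-independent n zero (tail ∘ b) (tail-independent {b = b} (λ ()) b-indep))
  #⊥-independent (suc n) (suc r) b b-indep with Fin.any? (λ i → ¬? (b i zero ≈? 0#))
  ... | yes (p , b₀≉0) =
    #⊥-reduced-step b p b₀≉0 (#⊥-independent n r reduced (reduced-independent b-indep))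
    where open Elimination b p b₀≉0
  ... | no  noPivot    =
    #⊥-tail-step b b₀≈0 (#⊥-independent n (suc r) (tail ∘ b) (tail-independent {b = b} b₀≈0 b-indep))
    where
    b₀≈0 : ∀ i → b i zero ≈ 0#
    b₀≈0 i = decidable-stable (b i zero ≈? 0#) (λ b₀≉0 → noPivot (i , b₀≉0))

  #⊥≡ : ∀ {n r N} (b : Fin r → Vect n) → LinearlyIndependent b → N * q ^ r ≡ q ^ n → #⊥ b ≡ N
  #⊥≡ {n} {r} {N} b b-indep N-count =
    ℕₚ.*-cancelʳ-≡ (#⊥ b) N (q ^ r) {{ℕₚ.m^n≢0 q r}}
      (trans (#⊥-independent n r b b-indep) (sym N-count))

  module DoubleCounting
    {n k f d : ℕ} (S : Fin (suc f) → Subspace n k)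
    (counts : ∀ (H : Hyperplane n) → HasCount (λ i → S i ⊆ʰ H) 0 ⊎ HasCount (λ i → S i ⊆ʰ H) d)
    (disjoint : ∀ i j → i ≢ j → TrivialIntersection (S i) (S j))
    {X Y : ℕ} (X-count : X * q ^ k ≡ q ^ n) (Y-count : Y * q ^ (k + k) ≡ q ^ n)
    where

    open ≡-Reasoning

    s : ℕ
    s = suc f

    B : Fin s → Fin k → Vect n
    B i = Subspace.basis (S i)

    incidences : Vect n → ℕ
    incidences a = sum (λ i → 𝟙 (a ⊥? B i))

    #⊥-single : ∀ i → #⊥ (B i) ≡ X
    #⊥-single i = #⊥≡ (B i) (Subspace.indep (S i)) X-count

    #⊥-pair : ∀ i j → i ≢ j → ∑ⱽ n (λ a → 𝟙 (a ⊥? B i) * 𝟙 (a ⊥? B j)) ≡ Y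
    #⊥-pair i j i≢j = begin
      ∑ⱽ n (λ a → 𝟙 (a ⊥? B i) * 𝟙 (a ⊥? B j))
        ≡⟨ ∑ⱽ-cong n (λ a → 𝟙-× (⊥-++⇔ a (B i) (B j)) (a ⊥? B i ++ B j) (a ⊥? B i) (a ⊥? B j)) ⟨
      #⊥ (B i ++ B j)
        ≡⟨ #⊥≡ (B i ++ B j) (++-independent (S i) (S j) (disjoint i j i≢j)) Y-count ⟩
      Y ∎

    ∑ⱽ-incidences : ∑ⱽ n incidences ≡ s * X
    ∑ⱽ-incidences = begin
      ∑ⱽ n incidences        ≡⟨ ∑ⱽ-sum n (λ i a → 𝟙 (a ⊥? B i)) ⟩
      sum (λ i → #⊥ (B i))   ≡⟨ sum-cong-≗ #⊥-single ⟩
      sum {s} (λ _ → X)      ≡⟨ sum-const s X ⟩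
      s * X                  ∎

    ∑ⱽ-incidences² : ∑ⱽ n (λ a → incidences a * incidences a) ≡ s * (X + f * Y)
    ∑ⱽ-incidences² = begin
      ∑ⱽ n (λ a → incidences a * incidences a)
        ≡⟨ ∑ⱽ-cong n square ⟩
      ∑ⱽ n (λ a → sum (λ i → sum (λ j → 𝟙ᵢ i a * 𝟙ᵢ j a)))
        ≡⟨ ∑ⱽ-sum n (λ i a → sum (λ j → 𝟙ᵢ i a * 𝟙ᵢ j a)) ⟩
      sum (λ i → ∑ⱽ n (λ a → sum (λ j → 𝟙ᵢ i a * 𝟙ᵢ j a)))
        ≡⟨ sum-cong-≗ (λ i → trans (∑ⱽ-sum n (λ j a → 𝟙ᵢ i a * 𝟙ᵢ j a)) (row i)) ⟩
      sum {s} (λ _ → X + f * Y)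
        ≡⟨ sum-const s (X + f * Y) ⟩
      s * (X + f * Y) ∎
      where
      𝟙ᵢ : Fin s → Vect n → ℕ
      𝟙ᵢ i a = 𝟙 (a ⊥? B i)
      square : ∀ a → incidences a * incidences a ≡ sum (λ i → sum (λ j → 𝟙ᵢ i a * 𝟙ᵢ j a))
      square a = trans (*-distribʳ-sum (incidences a) (λ i → 𝟙ᵢ i a))
                       (sum-cong-≗ (λ i → *-distribˡ-sum (𝟙ᵢ i a) (λ j → 𝟙ᵢ j a)))
      row : ∀ i → sum (λ j → ∑ⱽ n (λ a → 𝟙ᵢ i a * 𝟙ᵢ j a)) ≡ X + f * Y
      row i = begin
        sum (λ j → ∑ⱽ n (λ a → 𝟙ᵢ i a * 𝟙ᵢ j a))
          ≡⟨ sum-remove {i = i} (λ j → ∑ⱽ n (λ a → 𝟙ᵢ i a * 𝟙ᵢ j a)) ⟩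
        ∑ⱽ n (λ a → 𝟙ᵢ i a * 𝟙ᵢ i a) + sum (λ j → ∑ⱽ n (λ a → 𝟙ᵢ i a * 𝟙ᵢ (punchIn i j) a))
          ≡⟨ cong₂ _+_ (trans (∑ⱽ-cong n (λ a → 𝟙-idem (a ⊥? B i))) (#⊥-single i))
                       (sum-cong-≗ (λ j → #⊥-pair i (punchIn i j) (Fin.punchInᵢ≢i i j ∘ sym))) ⟩
        X + sum {f} (λ _ → Y)
          ≡⟨ cong (X +_) (sum-const f Y) ⟩
        X + f * Y ∎

    incidences-zero : ∀ {a} → IsZero a → incidences a ≡ s
    incidences-zero {a} a≈0 = begin
      incidences a       ≡⟨ sum-cong-≗ (λ i → 𝟙-yes (λ l → dot-zeroˡ (B i l) a≈0) (a ⊥? B i)) ⟩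
      sum {s} (λ _ → 1)  ≡⟨ sum-const s 1 ⟩
      s * 1              ≡⟨ ℕₚ.*-identityʳ s ⟩
      s                  ∎

    incidences-normal : ∀ H {m} → HasCount (λ i → S i ⊆ʰ H) m → incidences (Hyperplane.normal H) ≡ m
    incidences-normal H (σ , ∣σ∣≡m , ∈σ⇔) = begin
      incidences a
        ≡⟨ sum-cong-≗ (λ i → 𝟙-cong (⇔-sym (∈σ⇔ i) ⇔-∘ ⊥-basis⇔⊆ʰ H (S i)) (a ⊥? B i) (i ∈? σ)) ⟩
      sum (λ i → 𝟙 (i ∈? σ))
        ≡⟨ sum-𝟙-∈ σ ⟩
      ∣ σ ∣
        ≡⟨ ∣σ∣≡m ⟩
      _ ∎
      where a = Hyperplane.normal H

    incidences²-nonzero : ∀ {a} → ¬ IsZero a → incidences a * incidences a ≡ d * incidences a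
    incidences²-nonzero {a} a≉0 = byCount (counts H)
      where
      H : Hyperplane n
      H = record { normal = a ; nonzero = a≉0 }
      byCount : HasCount (λ i → S i ⊆ʰ H) 0 ⊎ HasCount (λ i → S i ⊆ʰ H) d
              → incidences a * incidences a ≡ d * incidences a
      byCount (inj₁ count₀) rewrite incidences-normal H count₀ = sym (ℕₚ.*-zeroʳ d)
      byCount (inj₂ count_d) = cong (_* incidences a) (incidences-normal H count_d)

    incidences²-pointwise : ∀ a → incidences a * incidences a + d * s * 𝟙 (isZero? a)
                                ≡ d * incidences a + s * s * 𝟙 (isZero? a)
    incidences²-pointwise a = byCases (isZero? a)
      where
      byCases : (a≈0? : Dec (IsZero a)) → incidences a * incidences a + d * s * 𝟙 a≈0?
                                          ≡ d * incidences a + s * s * 𝟙 a≈0?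
      byCases (yes a≈0) rewrite incidences-zero a≈0 = swap s d
        where
        swap : ∀ s d → s * s + d * s * 1 ≡ d * s + s * s * 1
        swap = solve-∀
      byCases (no a≉0) =
        cong₂ _+_ (incidences²-nonzero a≉0) (trans (ℕₚ.*-zeroʳ (d * s)) (sym (ℕₚ.*-zeroʳ (s * s))))

    design-identity : X + f * Y + d ≡ d * X + s
    design-identity = ℕₚ.*-cancelˡ-≡ _ _ s (begin
      s * (X + f * Y + d)
        ≡⟨ expand s X f Y d ⟩
      s * (X + f * Y) + d * s * 1
        ≡⟨ cong₂ _+_ (sym ∑ⱽ-incidences²) (cong (d * s *_) (sym (∑ⱽ-𝟙-isZero n))) ⟩
      ∑ⱽ n (λ a → c a * c a) + d * s * ∑ⱽ n z
        ≡⟨ cong (∑ⱽ n (λ a → c a * c a) +_) (∑ⱽ-*ˡ n (d * s) z) ⟨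
      ∑ⱽ n (λ a → c a * c a) + ∑ⱽ n (λ a → d * s * z a)
        ≡⟨ ∑ⱽ-+ n (λ a → c a * c a) (λ a → d * s * z a) ⟨
      ∑ⱽ n (λ a → c a * c a + d * s * z a)
        ≡⟨ ∑ⱽ-cong n incidences²-pointwise ⟩
      ∑ⱽ n (λ a → d * c a + s * s * z a)
        ≡⟨ ∑ⱽ-+ n (λ a → d * c a) (λ a → s * s * z a) ⟩
      ∑ⱽ n (λ a → d * c a) + ∑ⱽ n (λ a → s * s * z a)
        ≡⟨ cong₂ _+_ (∑ⱽ-*ˡ n d c) (∑ⱽ-*ˡ n (s * s) z) ⟩
      d * ∑ⱽ n c + s * s * ∑ⱽ n z
        ≡⟨ cong₂ _+_ (cong (d *_) ∑ⱽ-incidences) (cong (s * s *_) (∑ⱽ-𝟙-isZero n)) ⟩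
      d * (s * X) + s * s * 1
        ≡⟨ collect s X d ⟩
      s * (d * X + s)
        ∎)
      where
      c z : Vect n → ℕ
      c = incidences
      z a = 𝟙 (isZero? a)
      expand : ∀ s X f Y d → s * (X + f * Y + d) ≡ s * (X + f * Y) + d * s * 1
      expand = solve-∀
      collect : ∀ s X d → d * (s * X) + s * s * 1 ≡ s * (d * X + s)
      collect = solve-∀

-- With y = PQ - 1 the identity reads f y = e Q y + e (Q - 1); so y divides e (Q - 1), and y ≥ P (Q - 1).
divisibility-bound : ∀ {P Q e f} → 1 ≤ P → 2 ≤ Q → 1 ≤ e
                   → P * Q * Q + f * (P * Q) + suc e ≡ suc e * (P * Q * Q) + suc f → P ≤ e
divisibility-bound {suc p} {suc (suc u′)} {suc e′} {f} (s≤s z≤n) (s≤s (s≤s z≤n)) (s≤s z≤n) identity =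
  ℕₚ.*-cancelʳ-≤ P e u (begin
    P * u  ≤⟨ ℕₚ.+-monoʳ-≤ u (ℕₚ.*-monoʳ-≤ p (ℕₚ.n≤1+n u)) ⟩
    y      ≤⟨ ∣⇒≤ y∣e*u ⟩
    e * u  ∎)
  where
  open ℕₚ.≤-Reasoning
  P u Q e y : ℕ
  P = suc p
  u = suc u′
  Q = suc u
  e = suc e′
  y = u + p * Q
  f*y≡ : f * y ≡ e * Q * y + e * u
  f*y≡ = ℕₚ.+-cancelˡ-≡ (P * Q * Q + f + suc e) _ _
           (trans (sym (split-lhs p u f e)) (trans identity (split-rhs p u f e)))
    where
    split-lhs : ∀ p u f e → let Q = suc u; P = suc p in
      P * Q * Q + f * (P * Q) + suc e ≡ P * Q * Q + f + suc e + f * (u + p * Q)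
    split-lhs = solve-∀
    split-rhs : ∀ p u f e → let Q = suc u; P = suc p in
      suc e * (P * Q * Q) + suc f ≡ P * Q * Q + f + suc e + (e * Q * (u + p * Q) + e * u)
    split-rhs = solve-∀
  y∣e*u : y ∣ e * u
  y∣e*u = ∣m+n∣m⇒∣n (≡.subst (y ∣_) f*y≡ (n∣m*n f)) (n∣m*n (e * Q))

^-split-3k : ∀ q k {n} → 3 * k ≤ n → q ^ (n ∸ 3 * k) * q ^ k * q ^ k * q ^ k ≡ q ^ n
^-split-3k q k {n} 3k≤n = begin
  q ^ m * q ^ k * q ^ k * q ^ k  ≡⟨ cong (λ t → t * q ^ k * q ^ k) (ℕₚ.^-distribˡ-+-* q m k) ⟨
  q ^ (m + k) * q ^ k * q ^ k    ≡⟨ cong (_* q ^ k) (ℕₚ.^-distribˡ-+-* q (m + k) k) ⟨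
  q ^ (m + k + k) * q ^ k        ≡⟨ ℕₚ.^-distribˡ-+-* q (m + k + k) k ⟨
  q ^ (m + k + k + k)            ≡⟨ cong (q ^_) (trans (rearrange m k) (ℕₚ.m+[n∸m]≡n 3k≤n)) ⟩
  q ^ n                          ∎
  where
  open ≡-Reasoning
  m = n ∸ 3 * k
  rearrange : ∀ m k → m + k + k + k ≡ 3 * k + m
  rearrange = solve-∀

^-split-3k′ : ∀ q k {n} → 3 * k ≤ n → q ^ (n ∸ 3 * k) * q ^ k * q ^ (k + k) ≡ q ^ n
^-split-3k′ q k {n} 3k≤n = begin
  P * q ^ k * q ^ (k + k)      ≡⟨ cong (P * q ^ k *_) (ℕₚ.^-distribˡ-+-* q k k) ⟩
  P * q ^ k * (q ^ k * q ^ k)  ≡⟨ ℕₚ.*-assoc (P * q ^ k) (q ^ k) (q ^ k) ⟨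
  P * q ^ k * q ^ k * q ^ k    ≡⟨ ^-split-3k q k 3k≤n ⟩
  q ^ n                        ∎
  where
  open ≡-Reasoning
  P = q ^ (n ∸ 3 * k)

corollary5p13 : (q : ℕ) (F : FiniteField q) (n k s d : ℕ)
    → 1 ≤ k → 2 * k ≤ n → 2 ≤ s → 2 ≤ d
    → (S : Fin s → LinearAlgebra.Subspace F n k)
    → (∀ (H : LinearAlgebra.Hyperplane F n) → HasCount (λ i → LinearAlgebra._⊆ʰ_ F (S i) H) 0 ⊎ HasCount (λ i → LinearAlgebra._⊆ʰ_ F (S i) H) d)
    → (∃ λ (H : LinearAlgebra.Hyperplane F n) → HasCount (λ i → LinearAlgebra._⊆ʰ_ F (S i) H) 0)
    → (∃ λ (H : LinearAlgebra.Hyperplane F n) → HasCount (λ i → LinearAlgebra._⊆ʰ_ F (S i) H) d)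
    → (∀ i j → ¬ i ≡ j → LinearAlgebra.TrivialIntersection F (S i) (S j))
    → q ^ (n ∸ 3 * k) ≤ d ⊎ n ≤ 4 * k ∸ 1
corollary5p13 q F n k (suc f) (suc e) 1≤k _ _ (s≤s 1≤e) S counts _ _ disjoint with 3 * k ≤? n
... | no  n<3k = inj₁ (≡.subst (λ t → q ^ t ≤ suc e) (sym (ℕₚ.m≤n⇒m∸n≡0 (ℕₚ.<⇒≤ (ℕₚ.≰⇒> n<3k)))) (s≤s z≤n))
... | yes 3k≤n = inj₁ (ℕₚ.m≤n⇒m≤1+n (divisibility-bound (ℕₚ.m^n>0 q (n ∸ 3 * k)) (2≤q^ 1≤k) 1≤e
    (DoubleCounting.design-identity S counts disjoint (^-split-3k q k 3k≤n) (^-split-3k′ q k 3k≤n))))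
  where open Counting F
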